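{- If $w\in U_n$ and $F:S_n\to S_n$ is any homing shuffle, then $F(w)\in U_n$.
   Context: $[n]=\{1,\dots,n\}$; $S_n$ is the group of bijections $[n]\to[n]$. A homing shuffle is a map $F:S_n\to S_n$ such that for every $w\in S_n$, setting $k:=w(1)$: (a) $F(w)(k)=k$, and (b) $F(w)(i)=w(i)$ for all $i>k$. For $w\in S_n$, $i_w$ is the smallest $k\in[n]$ with $w([k])=[k]$. $U_n:=\{w\in S_n : \text{there is } i>i_w \text{ with } w(i)\neq i\}$. -}

module Defs where

open import Data.Nat using (ℕ; suc; _<_; _≤_; _≥_)
open import Data.Fin using (Fin; toℕ)
import Data.Fin as Fin
open import Data.Fin.Permutation using (Permutation′; _⟨$⟩ʳ_)
open import Data.Product using (Σ; _×_; ∃; _,_)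
open import Relation.Binary.PropositionalEquality using (_≡_; _≢_)
open import Relation.Nullary using (¬_)

-- Convention: [n] = {1,…,n} is represented by Fin n = {0,…,n-1};
-- the 1-indexed element i corresponds to the Fin element with toℕ = i - 1.
-- S_n is represented by Permutation′ n (bijections Fin n → Fin n).

S : ℕ → Set
S n = Permutation′ n

Stable : ∀ {n} → S n → ℕ → Set
Stable {n} w k =
  (∀ (x : Fin n) → toℕ x < k → toℕ (w ⟨$⟩ʳ x) < k) ×
  (∀ (y : Fin n) → toℕ y < k → ∃ λ (x : Fin n) → toℕ x < k × w ⟨$⟩ʳ x ≡ y)

IsIw : ∀ {n} → S n → ℕ → Set
IsIw {n} w k = (1 ≤ k × k ≤ n) × Stable w k × (∀ j → 1 ≤ j → j < k → ¬ Stable w j)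

-- U_n : there is i > i_w with w(i) ≠ i
-- (1-indexed i > k  ⇔  0-indexed toℕ x ≥ k)
InU : ∀ {n} → S n → Set
InU {n} w = ∃ λ k → IsIw w k × ∃ λ (x : Fin n) → toℕ x ≥ k × w ⟨$⟩ʳ x ≢ x

-- Homing shuffle on S_n: with k := w(1) (0-indexed: w applied to the Fin element o with toℕ o = 0),
-- (a) F(w)(k) = k, (b) F(w)(i) = w(i) for all i > k.
-- (For n = 0 there is no such o and the condition is vacuous, as in the paper.)
IsHoming : ∀ {n} → (S n → S n) → Set
IsHoming {n} F = ∀ (w : S n) (o : Fin n) → toℕ o ≡ 0 →
  (F w ⟨$⟩ʳ (w ⟨$⟩ʳ o) ≡ w ⟨$⟩ʳ o) ×
  (∀ (i : Fin n) → toℕ (w ⟨$⟩ʳ o) < toℕ i → F w ⟨$⟩ʳ i ≡ w ⟨$⟩ʳ i)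

-- A homing shuffle moves no position beyond w(1), and every position i ≥ i_w lies beyond w(1)
-- because w([i_w]) = [i_w]. So F(w) agrees with w on the tail {i ≥ i_w}, where w maps the
-- tail bijectively onto itself; hence F(w) also maps the tail onto itself and fixes the block
-- [i_w] setwise. Thus i_{F(w)} ≤ i_w, and the non-fixed tail point of w is one of F(w).
module Submission where

open import Defs
open import Data.Nat using (ℕ; zero; suc; _<_; _≤_; _≤?_; s≤s; z≤n)
open import Data.Nat.Properties using (≮⇒≥; ≰⇒>; <⇒≱; <-≤-trans; ≤-trans)
open import Data.Fin using (Fin; toℕ)
open import Data.Fin.Patterns using (0F)
open import Data.Fin.Permutation using (_⟨$⟩ʳ_; _⟨$⟩ˡ_; inverseˡ; inverseʳ)
open import Data.Fin.Properties using (all?)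
open import Data.Product using (∃; _×_; _,_; proj₁; proj₂)
open import Relation.Binary.PropositionalEquality using (_≡_; refl; sym; trans; cong; subst)
open import Relation.Nullary using (¬_; Dec; yes; no)
open import Relation.Nullary.Decidable using (map′; _×-dec_; _→-dec_)
open import Relation.Unary using (Decidable)

≤-contraposition : ∀ {a b k} → (k ≤ a → k ≤ b) → b < k → a < k
≤-contraposition f b<k = ≰⇒> λ k≤a → <⇒≱ b<k (f k≤a)

<-contraposition : ∀ {a b k} → (a < k → b < k) → k ≤ b → k ≤ a
<-contraposition f k≤b = ≮⇒≥ λ a<k → <⇒≱ (f a<k) k≤b

least-witness : ∀ {p} {P : ℕ → Set p} → Decidable P → ∀ {k} → P k →
                ∃ λ j → j ≤ k × P j × (∀ i → i < j → ¬ P i)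
least-witness P? {zero} Pk = zero , z≤n , Pk , λ _ ()
least-witness P? {suc k} Pk with P? zero
... | yes P0 = zero , z≤n , P0 , λ _ ()
... | no ¬P0 =
  let j , j≤k , Pj , minimal = least-witness (λ i → P? (suc i)) Pk in
  suc j , s≤s j≤k , Pj , λ { zero _ → ¬P0 ; (suc i) (s≤s i<j) → minimal i i<j }

module _ {n : ℕ} where

  ClosedAbove : (Fin n → Fin n) → ℕ → Set
  ClosedAbove f k = ∀ x → k ≤ toℕ x → k ≤ toℕ (f x)

  closedAbove? : ∀ f k → Dec (ClosedAbove f k)
  closedAbove? f k = all? λ x → (k ≤? toℕ x) →-dec (k ≤? toℕ (f x))

  ⟨$⟩ʳ-injective : ∀ (π : S n) {x y} → π ⟨$⟩ʳ x ≡ π ⟨$⟩ʳ y → x ≡ y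
  ⟨$⟩ʳ-injective π πx≡πy = trans (sym (inverseˡ π)) (trans (cong (π ⟨$⟩ˡ_) πx≡πy) (inverseˡ π))

  module _ (π : S n) {k : ℕ} where

    stable⇒closedAbove : Stable π k → ClosedAbove (π ⟨$⟩ʳ_) k × ClosedAbove (π ⟨$⟩ˡ_) k
    stable⇒closedAbove (closedBelow , onto) = closedAbove , closedAbove⁻¹
      where
      closedAbove : ClosedAbove (π ⟨$⟩ʳ_) k
      closedAbove x = <-contraposition λ πx<k →
        let x′ , x′<k , πx′≡πx = onto (π ⟨$⟩ʳ x) πx<k
        in subst (λ z → toℕ z < k) (⟨$⟩ʳ-injective π πx′≡πx) x′<k
      closedAbove⁻¹ : ClosedAbove (π ⟨$⟩ˡ_) k
      closedAbove⁻¹ y = <-contraposition λ π⁻¹y<k →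
        subst (λ z → toℕ z < k) (inverseʳ π) (closedBelow (π ⟨$⟩ˡ y) π⁻¹y<k)

    closedAbove⇒stable : ClosedAbove (π ⟨$⟩ʳ_) k → ClosedAbove (π ⟨$⟩ˡ_) k → Stable π k
    closedAbove⇒stable closedAbove closedAbove⁻¹ = closedBelow , onto
      where
      closedBelow : ∀ x → toℕ x < k → toℕ (π ⟨$⟩ʳ x) < k
      closedBelow x = ≤-contraposition λ k≤πx →
        subst (λ z → k ≤ toℕ z) (inverseˡ π) (closedAbove⁻¹ (π ⟨$⟩ʳ x) k≤πx)
      onto : ∀ y → toℕ y < k → ∃ λ x → toℕ x < k × π ⟨$⟩ʳ x ≡ y
      onto y y<k = π ⟨$⟩ˡ y , preimage<k , inverseʳ π
        where
        preimage<k : toℕ (π ⟨$⟩ˡ y) < k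
        preimage<k = ≤-contraposition (λ k≤π⁻¹y →
          subst (λ z → k ≤ toℕ z) (inverseʳ π) (closedAbove (π ⟨$⟩ˡ y) k≤π⁻¹y)) y<k

  stable? : (π : S n) → Decidable (Stable π)
  stable? π k = map′ (λ (up , down) → closedAbove⇒stable π up down) (stable⇒closedAbove π)
                     (closedAbove? (π ⟨$⟩ʳ_) k ×-dec closedAbove? (π ⟨$⟩ˡ_) k)

  stable-agreeingAbove : ∀ (σ π : S n) {k} → (∀ x → k ≤ toℕ x → σ ⟨$⟩ʳ x ≡ π ⟨$⟩ʳ x) →
                         Stable π k → Stable σ k
  stable-agreeingAbove σ π {k} agree stable =
    closedAbove⇒stable σ
      (λ x k≤x → subst (λ z → k ≤ toℕ z) (sym (agree x k≤x)) (up x k≤x))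
      (λ y k≤y → subst (λ z → k ≤ toℕ z) (sym (inverses-agree y k≤y)) (down y k≤y))
    where
    up = proj₁ (stable⇒closedAbove π stable)
    down = proj₂ (stable⇒closedAbove π stable)
    inverses-agree : ∀ y → k ≤ toℕ y → σ ⟨$⟩ˡ y ≡ π ⟨$⟩ˡ y
    inverses-agree y k≤y = ⟨$⟩ʳ-injective σ
      (trans (inverseʳ σ) (trans (sym (inverseʳ π)) (sym (agree (π ⟨$⟩ˡ y) (down y k≤y)))))

  isIw-exists : ∀ (π : S n) {k} → 1 ≤ k → k ≤ n → Stable π k → ∃ λ j → j ≤ k × IsIw π j
  isIw-exists π {suc k} _ k<n stable =
    let j , j≤k , stable-j , minimal = least-witness (λ i → stable? π (suc i)) stable in
    suc j , s≤s j≤k , (s≤s z≤n , ≤-trans (s≤s j≤k) k<n) , stable-j ,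
    λ { (suc i) _ (s≤s i<j) → minimal i i<j }

lemma3 : ∀ (n : ℕ) (F : S n → S n) → IsHoming F → (w : S n) → InU w → InU (F w)
lemma3 zero F homing w (_ , _ , () , _)
lemma3 (suc n) F homing w (k , ((1≤k , k≤n) , stable , _) , x , k≤x , wx≢x) =
  let j , j≤k , iw = isIw-exists (F w) 1≤k k≤n (stable-agreeingAbove (F w) w agreeAbove stable)
  in j , iw , x , ≤-trans j≤k k≤x , λ Fwx≡x → wx≢x (trans (sym (agreeAbove x k≤x)) Fwx≡x)
  where
  agreeAbove : ∀ i → k ≤ toℕ i → F w ⟨$⟩ʳ i ≡ w ⟨$⟩ʳ i
  agreeAbove i k≤i = proj₂ (homing w 0F refl) i (<-≤-trans (proj₁ stable 0F 1≤k) k≤i)
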